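{- Let $m=2^n$ with $n>1$, and let $S=\{s_1,s_2,\ldots,s_k,\frac m2\}$ be a subset of $\{1,2,\ldots,\frac m2\}$ with $s_1,\ldots,s_k$ distinct from $\frac m2$. Let $S'=\{\frac m2-s_1,\frac m2-s_2,\ldots,\frac m2-s_k\}$. Then the circulant graph $G_1=C_m(S)$ is an open XOR-magic graph if and only if the circulant graph $G_2=C_m(S')$ is a closed XOR-magic graph.
   Context: For $m\ge 4$ and $S\subseteq\{1,2,\ldots,\lfloor m/2\rfloor\}$, the circulant graph $C_m(S)$ has vertices $x_0,\ldots,x_{m-1}$, and distinct $x_i,x_j$ are adjacent if and only if $|i-j|\in\{s,\,m-s : s\in S\}$. For a vertex $x$, $N(x)$ is its set of neighbours and $N[x]=N(x)\cup\{x\}$. A simple connected graph $G=(V,E)$ with $|V|=2^n$ is an open XOR-magic graph (of power $n$) if there is a bijection $\ell:V\to(\mathbb{Z}_2)^n$ with $\sum_{y\in N(x)}\ell(y)=0$ for all $x\in V$, and a closed XOR-magic graph (of power $n$) if there is a bijection $\ell:V\to(\mathbb{Z}_2)^n$ with $\sum_{y\in N[x]}\ell(y)=0$ for all $x\in V$ (sums in $(\mathbb{Z}_2)^n$). -}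

module Defs where

open import Data.Nat using (ℕ; zero; suc; _∸_; _^_; ∣_-_∣; _≡ᵇ_)

open import Data.Bool using (Bool; true; false; _∧_; _∨_; not; _xor_; if_then_else_)
open import Data.Fin using (Fin; toℕ)
open import Data.List using (List; _∷_; []; map; foldr; allFin)
open import Data.Bool.ListAction using (any)
open import Data.Vec using (Vec; replicate; zipWith)
open import Data.Product using (Σ; _×_)
open import Function.Bundles using (_⤖_; Bijection)
open import Relation.Binary.PropositionalEquality using (_≡_)

-- (ℤ₂)ⁿ as bit vectors, addition = componentwise XOR
Z2n : ℕ → Set
Z2n n = Vec Bool n

0ᵥ : ∀ {n} → Z2n n
0ᵥ = replicate _ false

_⊕_ : ∀ {n} → Z2n n → Z2n n → Z2n n
_⊕_ = zipWith _xor_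

Graph : ℕ → Set
Graph N = Fin N → Fin N → Bool

circulant : (m : ℕ) → List ℕ → Graph m
circulant m S i j =
  not (toℕ i ≡ᵇ toℕ j) ∧
  any (λ s → (∣ toℕ i - toℕ j ∣ ≡ᵇ s) ∨ (∣ toℕ i - toℕ j ∣ ≡ᵇ (m ∸ s))) S

data Reach {N : ℕ} (G : Graph N) : Fin N → Fin N → Set where
  here : ∀ {x} → Reach G x x
  step : ∀ {x y z} → G x y ≡ true → Reach G y z → Reach G x z

Connected : ∀ {N} → Graph N → Set
Connected {N} G = (x y : Fin N) → Reach G x y

openNbSum : ∀ {N n} → Graph N → (Fin N → Z2n n) → Fin N → Z2n n
openNbSum {N} G ℓ x =
  foldr (λ y acc → if G x y then ℓ y ⊕ acc else acc) 0ᵥ (allFin N)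

closedNbSum : ∀ {N n} → Graph N → (Fin N → Z2n n) → Fin N → Z2n n
closedNbSum G ℓ x = ℓ x ⊕ openNbSum G ℓ x

OpenXORMagic : (n : ℕ) → Graph (2 ^ n) → Set
OpenXORMagic n G =
  Connected G ×
  Σ (Fin (2 ^ n) ⤖ Z2n n) λ ℓ →
    ∀ x → openNbSum G (Bijection.to ℓ) x ≡ 0ᵥ

ClosedXORMagic : (n : ℕ) → Graph (2 ^ n) → Set
ClosedXORMagic n G =
  Connected G ×
  Σ (Fin (2 ^ n) ⤖ Z2n n) λ ℓ →
    ∀ x → closedNbSum G (Bijection.to ℓ) x ≡ 0ᵥ

module Submission where

-- Write m = 2h and let σ x = x + h (mod m) be the antipodal map. For a jump s ≤ h,
-- y - σ x ≡ ±s iff y - x ≡ h ± s ≡ ∓(h - s) (mod m), and the jump h joins σ x to x itself.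
-- So the open neighbourhood of σ x in G₁ = C_m(S) is the closed neighbourhood of x in
-- G₂ = C_m(S′), and a labelling has vanishing open sums on G₁ iff it has vanishing closed
-- sums on G₂. Connectivity agrees too: as n > 1, h is even, so h - s has the parity of s.
-- If all jumps are even, every edge preserves parity; an odd jump is a unit modulo 2ⁿ and
-- its multiples reach every vertex.

open import Data.Bool using (Bool; true; false; not; _∧_; _∨_; _xor_; if_then_else_; T)
open import Data.Bool.ListAction using (any)
open import Data.Bool.Properties
  using (xor-assoc; xor-comm; xor-identityˡ; xor-identityʳ; xor-same; T-∨; T-∧; T-≡)
open import Data.Empty using (⊥-elim)
open import Data.Fin using (Fin; zero; suc; toℕ; fromℕ<)
open import Data.Fin.Properties using (toℕ-fromℕ<; toℕ-injective; toℕ<n)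
open import Data.List using (List; []; _∷_; map; foldr; allFin; tabulate)
open import Data.List.Membership.Propositional using (_∈_; lose; find)
open import Data.List.Membership.Propositional.Properties using (∈-map⁺)
open import Data.List.Properties using (foldr-map; map-tabulate)
open import Data.List.Relation.Unary.All as All using (All; []; _∷_; lookupAny)
open import Data.List.Relation.Unary.All.Properties using (All¬⇒¬Any; ¬Any⇒All¬; map⁺)
open import Data.List.Relation.Unary.Any using (Any; here; there; any?)
open import Data.List.Relation.Unary.Any.Properties using (any⁺; any⁻) renaming (map⁻ to Any-map⁻)
open import Data.Nat
  using (ℕ; zero; suc; pred; _+_; _*_; _∸_; _^_; _≤_; _<_; _<?_; ∣_-_∣; _≡ᵇ_;
         NonZero; ≢-nonZero⁻¹; s≤s; z≤n)
open import Data.Nat.Coprimality using (Coprime; coprime-Bézout; coprime-divisor)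
open import Data.Nat.Divisibility
  using (_∣_; _∤_; _∣?_; divides; divides-refl; ∣⇒≤; ∣-trans; ∣1⇒≡1; 0∣⇒≡0; m∣m*n;
         ∣m+n∣m⇒∣n)
open import Data.Nat.DivMod
open import Data.Nat.GCD using (module Bézout)
open import Data.Nat.Properties
open import Data.Nat.Tactic.RingSolver using (solve-∀)
open import Data.Product using (_×_; _,_; proj₂; ∃-syntax)
open import Data.Sum as Sum using (_⊎_; inj₁; inj₂)
open import Data.Unit using (tt)
open import Data.Vec using ([]; _∷_)
open import Data.Vec.Properties using (zipWith-assoc; zipWith-comm; zipWith-identityˡ; zipWith-identityʳ)
open import Function using (id; _∘_; flip)
open import Function.Bundles using (_⇔_; mk⇔; Equivalence; Bijection)
import Function.Properties.Equivalence as ⇔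
open import Relation.Binary.PropositionalEquality
  using (_≡_; _≢_; refl; sym; trans; cong; cong₂; subst; module ≡-Reasoning)
open import Relation.Nullary using (¬_; yes; no; ¬?; contradiction)
open import Relation.Nullary.Decidable using (decidable-stable)

open import Defs

-- Sums in (ℤ₂)ⁿ

module _ {k : ℕ} where

  ⊕-assoc : (u v w : Z2n k) → (u ⊕ v) ⊕ w ≡ u ⊕ (v ⊕ w)
  ⊕-assoc = zipWith-assoc xor-assoc

  ⊕-comm : (u v : Z2n k) → u ⊕ v ≡ v ⊕ u
  ⊕-comm = zipWith-comm xor-comm

  ⊕-identityˡ : (v : Z2n k) → 0ᵥ ⊕ v ≡ v
  ⊕-identityˡ = zipWith-identityˡ xor-identityˡ

  ⊕-identityʳ : (v : Z2n k) → v ⊕ 0ᵥ ≡ v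
  ⊕-identityʳ = zipWith-identityʳ xor-identityʳ

  ⊕-left-comm : (u v w : Z2n k) → u ⊕ (v ⊕ w) ≡ v ⊕ (u ⊕ w)
  ⊕-left-comm u v w = begin
    u ⊕ (v ⊕ w) ≡⟨ ⊕-assoc u v w ⟨
    (u ⊕ v) ⊕ w ≡⟨ cong (_⊕ w) (⊕-comm u v) ⟩
    (v ⊕ u) ⊕ w ≡⟨ ⊕-assoc v u w ⟩
    v ⊕ (u ⊕ w) ∎
    where open ≡-Reasoning

⊕-self : ∀ {k} (v : Z2n k) → v ⊕ v ≡ 0ᵥ
⊕-self [] = refl
⊕-self (b ∷ v) = cong₂ _∷_ (xor-same b) (⊕-self v)

module _ {k : ℕ} {A : Set} where

  -- openNbSum G f x unfolds to maskedSum (G x) f (allFin N).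
  maskedSum : (A → Bool) → (A → Z2n k) → List A → Z2n k
  maskedSum c f = foldr (λ y acc → if c y then f y ⊕ acc else acc) 0ᵥ

  maskedSum-cong : ∀ {c d} (f : A → Z2n k) → (∀ y → c y ≡ d y) →
                   ∀ ys → maskedSum c f ys ≡ maskedSum d f ys
  maskedSum-cong f c≗d [] = refl
  maskedSum-cong {d = d} f c≗d (y ∷ ys) rewrite c≗d y =
    cong (λ acc → if d y then f y ⊕ acc else acc) (maskedSum-cong f c≗d ys)

  maskedSum-false : ∀ (f : A → Z2n k) ys → maskedSum (λ _ → false) f ys ≡ 0ᵥ
  maskedSum-false f [] = refl
  maskedSum-false f (_ ∷ ys) = maskedSum-false f ys

  maskedSum-xor : ∀ c d (f : A → Z2n k) ys →
                  maskedSum (λ y → c y xor d y) f ys ≡ maskedSum c f ys ⊕ maskedSum d f ys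
  maskedSum-xor c d f [] = sym (⊕-identityˡ 0ᵥ)
  maskedSum-xor c d f (y ∷ ys) with c y | d y
  ... | false | false = maskedSum-xor c d f ys
  ... | true  | false = trans (cong (f y ⊕_) (maskedSum-xor c d f ys)) (sym (⊕-assoc (f y) _ _))
  ... | false | true  = trans (cong (f y ⊕_) (maskedSum-xor c d f ys)) (⊕-left-comm (f y) _ _)
  ... | true  | true  = begin
    maskedSum (λ y → c y xor d y) f ys ≡⟨ maskedSum-xor c d f ys ⟩
    Σc ⊕ Σd                             ≡⟨ ⊕-identityˡ (Σc ⊕ Σd) ⟨
    0ᵥ ⊕ (Σc ⊕ Σd)                      ≡⟨ cong (_⊕ (Σc ⊕ Σd)) (⊕-self (f y)) ⟨
    (f y ⊕ f y) ⊕ (Σc ⊕ Σd)             ≡⟨ ⊕-assoc (f y) (f y) (Σc ⊕ Σd) ⟩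
    f y ⊕ (f y ⊕ (Σc ⊕ Σd))             ≡⟨ cong (f y ⊕_) (⊕-left-comm (f y) Σc Σd) ⟩
    f y ⊕ (Σc ⊕ (f y ⊕ Σd))             ≡⟨ ⊕-assoc (f y) Σc (f y ⊕ Σd) ⟨
    (f y ⊕ Σc) ⊕ (f y ⊕ Σd)             ∎
    where
    open ≡-Reasoning
    Σc Σd : Z2n k
    Σc = maskedSum c f ys
    Σd = maskedSum d f ys

maskedSum-map : ∀ {k} {A B : Set} c (f : A → Z2n k) (g : B → A) ys →
                maskedSum c f (map g ys) ≡ maskedSum (c ∘ g) (f ∘ g) ys
maskedSum-map c f g = foldr-map _ g 0ᵥ

maskedSum-tabulate-suc : ∀ {N k} c (f : Fin (suc N) → Z2n k) →
                         maskedSum c f (tabulate suc) ≡ maskedSum (c ∘ suc) (f ∘ suc) (allFin N)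
maskedSum-tabulate-suc c f =
  trans (cong (maskedSum c f) (sym (map-tabulate id suc))) (maskedSum-map c f suc (allFin _))

maskedSum-indicator : ∀ {N k} (x : Fin N) (f : Fin N → Z2n k) →
                      maskedSum (λ y → toℕ x ≡ᵇ toℕ y) f (allFin N) ≡ f x
maskedSum-indicator zero f =
  trans (cong (f zero ⊕_) (trans (maskedSum-tabulate-suc (λ y → 0 ≡ᵇ toℕ y) f)
                                 (maskedSum-false (f ∘ suc) (allFin _))))
        (⊕-identityʳ (f zero))
maskedSum-indicator (suc x) f =
  trans (maskedSum-tabulate-suc (λ y → suc (toℕ x) ≡ᵇ toℕ y) f) (maskedSum-indicator x (f ∘ suc))

openNbSum≡closedNbSum : ∀ {N k} (G H : Graph N) (f : Fin N → Z2n k) {z x : Fin N} →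
                        (∀ y → G z y ≡ (toℕ x ≡ᵇ toℕ y) xor H x y) →
                        openNbSum G f z ≡ closedNbSum H f x
openNbSum≡closedNbSum {N} G H f {z} {x} G≗δ⊕H = begin
  openNbSum G f z                                            ≡⟨ maskedSum-cong f G≗δ⊕H (allFin N) ⟩
  maskedSum (λ y → (toℕ x ≡ᵇ toℕ y) xor H x y) f (allFin N)  ≡⟨ maskedSum-xor _ (H x) f (allFin N) ⟩
  maskedSum (λ y → toℕ x ≡ᵇ toℕ y) f (allFin N) ⊕ openNbSum H f x
    ≡⟨ cong (_⊕ openNbSum H f x) (maskedSum-indicator x f) ⟩
  closedNbSum H f x                                          ∎
  where open ≡-Reasoning

-- Circulant adjacency modulo m

T⇔T⇒≡ : ∀ {a b} → T a ⇔ T b → a ≡ b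
T⇔T⇒≡ {false} {false} _   = refl
T⇔T⇒≡ {false} {true}  a⇔b = ⊥-elim (Equivalence.from a⇔b tt)
T⇔T⇒≡ {true}  {false} a⇔b = ⊥-elim (Equivalence.to a⇔b tt)
T⇔T⇒≡ {true}  {true}  _   = refl

∨≡xor-not-∧ : ∀ a b → a ∨ b ≡ a xor (not a ∧ b)
∨≡xor-not-∧ false b = refl
∨≡xor-not-∧ true  b = refl

not-∧-redundant : ∀ a b → (T b → ¬ T a) → not a ∧ b ≡ b
not-∧-redundant false b     _      = refl
not-∧-redundant true  false _      = refl
not-∧-redundant true  true  b⇒¬a = ⊥-elim (b⇒¬a tt tt)

∣m-n∣≡d⇒m+d≡n⊎n+d≡m : ∀ {m n d} → ∣ m - n ∣ ≡ d → m + d ≡ n ⊎ n + d ≡ m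
∣m-n∣≡d⇒m+d≡n⊎n+d≡m {m} {n} refl with ≤-total m n
... | inj₁ m≤n = inj₁ (trans (cong (m +_) (m≤n⇒∣m-n∣≡n∸m m≤n)) (m+[n∸m]≡n m≤n))
... | inj₂ n≤m = inj₂ (trans (cong (n +_) (m≤n⇒∣n-m∣≡n∸m n≤m)) (m+[n∸m]≡n n≤m))

m+d≡n⇒∣m-n∣≡d : ∀ {m n d} → m + d ≡ n → ∣ m - n ∣ ≡ d
m+d≡n⇒∣m-n∣≡d {m} {d = d} refl = ∣m-m+n∣≡n m d

∣m∣n⇒∣m∸n : ∀ {d m n} → d ∣ m → d ∣ n → d ∣ m ∸ n
∣m∣n⇒∣m∸n {d} (divides-refl p) (divides-refl q) = divides (p ∸ q) (sym (*-distribʳ-∸ d p q))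

Reach-trans : ∀ {N} {G : Graph N} {x y z} → Reach G x y → Reach G y z → Reach G x z
Reach-trans here       q = q
Reach-trans (step e p) q = step e (Reach-trans p q)

d∣∣m-n∣⇒m%d≡n%d : ∀ {d m n} .{{_ : NonZero d}} → d ∣ ∣ m - n ∣ → m % d ≡ n % d
d∣∣m-n∣⇒m%d≡n%d {d} {m} {n} d∣dist with ∣m-n∣≡d⇒m+d≡n⊎n+d≡m {m} {n} refl
... | inj₁ m+dist≡n = trans (sym (%-remove-+ʳ m d∣dist)) (cong (_% d) m+dist≡n)
... | inj₂ n+dist≡m = sym (trans (sym (%-remove-+ʳ n d∣dist)) (cong (_% d) n+dist≡m))

∣m∸n⇔∣n : ∀ {d m n} → d ∣ m → n ≤ m → d ∣ m ∸ n ⇔ d ∣ n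
∣m∸n⇔∣n d∣m n≤m = mk⇔
  (∣m+n∣m⇒∣n (subst (_ ∣_) (sym (m∸n+n≡m n≤m)) d∣m))
  (∣m∣n⇒∣m∸n d∣m)

ProperJump : ℕ → ℕ → Set
ProperJump m s = 0 < s × s < m

module Circulant (m : ℕ) .{{_ : NonZero m}} where

  infix 4 _≋_
  _≋_ : ℕ → ℕ → Set
  a ≋ b = a % m ≡ b % m

  ≋-+ʳ : ∀ {a b} c → a ≋ b → a + c ≋ b + c
  ≋-+ʳ {a} {b} c a≋b = begin
    (a + c) % m             ≡⟨ %-distribˡ-+ a c m ⟩
    (a % m + c % m) % m     ≡⟨ cong (λ r → (r + c % m) % m) a≋b ⟩
    (b % m + c % m) % m     ≡⟨ %-distribˡ-+ b c m ⟨
    (b + c) % m             ∎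
    where open ≡-Reasoning

  ≋-+ˡ : ∀ c {a b} → a ≋ b → c + a ≋ c + b
  ≋-+ˡ c {a} {b} a≋b = trans (cong (_% m) (+-comm c a)) (trans (≋-+ʳ c a≋b) (cong (_% m) (+-comm b c)))

  +m≋ : ∀ a → a + m ≋ a
  +m≋ a = [m+n]%n≡m%n a m

  ≋⇒≡ : ∀ {a b} → a < m → b < m → a ≋ b → a ≡ b
  ≋⇒≡ a<m b<m a≋b = trans (sym (m<n⇒m%n≡m a<m)) (trans a≋b (m<n⇒m%n≡m b<m))

  ≋-wrap : ∀ {a b} → a < m → b < m + m → a ≋ b → b ≡ a ⊎ b ≡ a + m
  ≋-wrap {a} {b} a<m b<2m a≋b with b <? m
  ... | yes b<m = inj₁ (sym (≋⇒≡ a<m b<m a≋b))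
  ... | no  b≮m = inj₂ (begin
    b          ≡⟨ m∸n+n≡m m≤b ⟨
    b ∸ m + m  ≡⟨ cong (_+ m) (≋⇒≡ (m<n+o⇒m∸n<o b m b<2m) a<m b∸m≋a) ⟩
    a + m      ∎)
    where
    open ≡-Reasoning
    m≤b : m ≤ b
    m≤b = ≮⇒≥ b≮m
    b∸m≋a : b ∸ m ≋ a
    b∸m≋a = trans (m≤n⇒[n∸m]%m≡n%m m≤b) (sym a≋b)

  Jump : ℕ → ℕ → ℕ → Set
  Jump s u v = u + s ≋ v ⊎ u + (m ∸ s) ≋ v

  jumpsBy : ℕ → ℕ → ℕ → Bool
  jumpsBy u v s = (∣ u - v ∣ ≡ᵇ s) ∨ (∣ u - v ∣ ≡ᵇ m ∸ s)

  reverse-jump : ∀ {c c′ u v} → c + c′ ≡ m → v + c ≡ u → u + c′ ≋ v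
  reverse-jump {c} {c′} {u} {v} c+c′≡m refl = begin
    (v + c + c′) % m   ≡⟨ cong (_% m) (trans (+-assoc v c c′) (cong (v +_) c+c′≡m)) ⟩
    (v + m) % m        ≡⟨ +m≋ v ⟩
    v % m              ∎
    where open ≡-Reasoning

  dist-≡⇒Jump : ∀ {u v s} → s ≤ m → ∣ u - v ∣ ≡ s ⊎ ∣ u - v ∣ ≡ m ∸ s → Jump s u v
  dist-≡⇒Jump s≤m (inj₁ d≡s) with ∣m-n∣≡d⇒m+d≡n⊎n+d≡m d≡s
  ... | inj₁ u+s≡v = inj₁ (cong (_% m) u+s≡v)
  ... | inj₂ v+s≡u = inj₂ (reverse-jump (m+[n∸m]≡n s≤m) v+s≡u)
  dist-≡⇒Jump s≤m (inj₂ d≡m∸s) with ∣m-n∣≡d⇒m+d≡n⊎n+d≡m d≡m∸s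
  ... | inj₁ u+m∸s≡v = inj₂ (cong (_% m) u+m∸s≡v)
  ... | inj₂ v+m∸s≡u = inj₁ (reverse-jump (m∸n+n≡m s≤m) v+m∸s≡u)

  +≋⇒dist-≡ : ∀ {u v c} → u < m → v < m → c ≤ m → u + c ≋ v →
              ∣ u - v ∣ ≡ c ⊎ ∣ u - v ∣ ≡ m ∸ c
  +≋⇒dist-≡ {u} {v} {c} u<m v<m c≤m u+c≋v with ≋-wrap v<m (+-mono-<-≤ u<m c≤m) (sym u+c≋v)
  ... | inj₁ u+c≡v   = inj₁ (m+d≡n⇒∣m-n∣≡d u+c≡v)
  ... | inj₂ u+c≡v+m = inj₂ (trans (∣-∣-comm u v) (m+d≡n⇒∣m-n∣≡d (begin
    v + (m ∸ c)  ≡⟨ +-∸-assoc v c≤m ⟨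
    v + m ∸ c    ≡⟨ cong (_∸ c) u+c≡v+m ⟨
    u + c ∸ c    ≡⟨ m+n∸n≡m u c ⟩
    u            ∎)))
    where open ≡-Reasoning

  T-jumpsBy⇔Jump : ∀ {u v s} → u < m → v < m → s ≤ m → T (jumpsBy u v s) ⇔ Jump s u v
  T-jumpsBy⇔Jump {u} {v} {s} u<m v<m s≤m = mk⇔
    (λ t → dist-≡⇒Jump s≤m (Sum.map (≡ᵇ⇒≡ _ _) (≡ᵇ⇒≡ _ _) (Equivalence.to T-∨ t)))
    (λ j → Equivalence.from T-∨ (Sum.map (≡⇒≡ᵇ _ _) (≡⇒≡ᵇ _ _) (Jump⇒dist-≡ j)))
    where
    Jump⇒dist-≡ : Jump s u v → ∣ u - v ∣ ≡ s ⊎ ∣ u - v ∣ ≡ m ∸ s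
    Jump⇒dist-≡ (inj₁ u+s≋v)   = +≋⇒dist-≡ u<m v<m s≤m u+s≋v
    Jump⇒dist-≡ (inj₂ u+m∸s≋v) =
      Sum.swap (Sum.map₂ (λ d≡m∸[m∸s] → trans d≡m∸[m∸s] (m∸[m∸n]≡n s≤m))
                         (+≋⇒dist-≡ u<m v<m (m∸n≤m m s) u+m∸s≋v))

  jumpsBy-zero : ∀ {u v} → u < m → v < m → jumpsBy u v 0 ≡ (u ≡ᵇ v)
  jumpsBy-zero {u} {v} u<m v<m = T⇔T⇒≡ (⇔.trans (T-jumpsBy⇔Jump u<m v<m z≤n)
    (mk⇔ (≡⇒≡ᵇ u v ∘ Jump-zero⇒≡) (≡⇒Jump-zero ∘ ≡ᵇ⇒≡ u v)))
    where
    Jump-zero⇒≡ : Jump 0 u v → u ≡ v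
    Jump-zero⇒≡ (inj₁ u+0≋v) = ≋⇒≡ u<m v<m (trans (cong (_% m) (sym (+-identityʳ u))) u+0≋v)
    Jump-zero⇒≡ (inj₂ u+m≋v) = ≋⇒≡ u<m v<m (trans (sym (+m≋ u)) u+m≋v)
    ≡⇒Jump-zero : u ≡ v → Jump 0 u v
    ≡⇒Jump-zero u≡v = inj₁ (cong (_% m) (trans (+-identityʳ u) u≡v))

  ¬jumpsBy-self : ∀ {u s} → ProperJump m s → ¬ T (jumpsBy u u s)
  ¬jumpsBy-self {u} (0<s , s<m) t with Equivalence.to T-∨ t
  ... | inj₁ d≡s   = <⇒≢ 0<s (trans (sym (∣n-n∣≡0 u)) (≡ᵇ⇒≡ _ _ d≡s))
  ... | inj₂ d≡m∸s = <⇒≢ (m<n⇒0<n∸m s<m) (trans (sym (∣n-n∣≡0 u)) (≡ᵇ⇒≡ _ _ d≡m∸s))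

  circulant≡any : ∀ {S} → All (ProperJump m) S →
                  ∀ i j → circulant m S i j ≡ any (jumpsBy (toℕ i) (toℕ j)) S
  circulant≡any {S} proper i j = not-∧-redundant (toℕ i ≡ᵇ toℕ j) _ λ adj i≡ᵇj →
    All¬⇒¬Any (All.map (¬jumpsBy-self {toℕ i}) proper)
              (any⁻ _ S (subst (λ v → T (any (jumpsBy (toℕ i) v) S)) (sym (≡ᵇ⇒≡ _ _ i≡ᵇj)) adj))

  _⊞_ : Fin m → ℕ → Fin m
  x ⊞ c = fromℕ< (m%n<n (toℕ x + c) m)

  toℕ-⊞ : ∀ x c → toℕ (x ⊞ c) ≋ toℕ x + c
  toℕ-⊞ x c = trans (cong (_% m) (toℕ-fromℕ< _)) (m%n%n≡m%n (toℕ x + c) m)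

  toℕ-≋⇒≡ : ∀ {x y : Fin m} → toℕ x ≋ toℕ y → x ≡ y
  toℕ-≋⇒≡ {x} {y} = toℕ-injective ∘ ≋⇒≡ (toℕ<n x) (toℕ<n y)

  reach-by-steps : ∀ {G : Graph m} c → (∀ x → Reach G x (x ⊞ c)) →
                   ∀ k {x y} → toℕ x + k * c ≋ toℕ y → Reach G x y
  reach-by-steps c c-step zero {x} x+0≋y =
    subst (Reach _ x) (toℕ-≋⇒≡ (trans (cong (_% m) (sym (+-identityʳ (toℕ x)))) x+0≋y)) here
  reach-by-steps c c-step (suc k) {x} {y} x+[1+k]c≋y =
    Reach-trans (c-step x) (reach-by-steps c c-step k (begin
      (toℕ (x ⊞ c) + k * c) % m  ≡⟨ ≋-+ʳ (k * c) (toℕ-⊞ x c) ⟩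
      (toℕ x + c + k * c) % m    ≡⟨ cong (_% m) (+-assoc (toℕ x) c (k * c)) ⟩
      (toℕ x + suc k * c) % m    ≡⟨ x+[1+k]c≋y ⟩
      toℕ y % m                  ∎))
    where open ≡-Reasoning

  coprime⇒invertible : ∀ {g} → Coprime g m → ∃[ k ] k * g ≋ 1
  coprime⇒invertible {g} g⊥m with coprime-Bézout g⊥m
  ... | Bézout.+- x y 1+ym≡xg = x , (begin
    x * g % m        ≡⟨ cong (_% m) 1+ym≡xg ⟨
    (1 + y * m) % m  ≡⟨ [m+kn]%n≡m%n 1 y m ⟩
    1 % m            ∎)
    where open ≡-Reasoning
  -- Here x g ≡ -1, so x (m - 1) inverts g.
  ... | Bézout.-+ x y 1+xg≡ym = x * pred m , (begin
    x * pred m * g % m                  ≡⟨ [m+kn]%n≡m%n (x * pred m * g) y m ⟨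
    (x * pred m * g + y * m) % m        ≡⟨ cong (λ r → (x * pred m * g + r) % m) 1+xg≡ym ⟨
    (x * pred m * g + (1 + x * g)) % m  ≡⟨ cong (_% m) (rearrange x (pred m) g) ⟩
    (1 + x * g * suc (pred m)) % m      ≡⟨ cong (λ r → (1 + x * g * r) % m) (suc-pred m) ⟩
    (1 + x * g * m) % m                 ≡⟨ [m+kn]%n≡m%n 1 (x * g) m ⟩
    1 % m                               ∎)
    where
    open ≡-Reasoning
    rearrange : ∀ x p g → x * p * g + (1 + x * g) ≡ 1 + x * g * suc p
    rearrange = solve-∀

  jump-adjacent : ∀ {S g} → All (ProperJump m) S → g ∈ S → ∀ x → circulant m S x (x ⊞ g) ≡ true
  jump-adjacent {S} {g} proper g∈S x =
    trans (circulant≡any proper x (x ⊞ g)) (Equivalence.to T-≡ (any⁺ _ (lose g∈S jumps)))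
    where
    jumps : T (jumpsBy (toℕ x) (toℕ (x ⊞ g)) g)
    jumps = Equivalence.from
      (T-jumpsBy⇔Jump (toℕ<n x) (toℕ<n (x ⊞ g)) (<⇒≤ (proj₂ (All.lookup proper g∈S))))
      (inj₁ (sym (toℕ-⊞ x g)))

  coprime-jump⇒connected : ∀ {S g} → All (ProperJump m) S → g ∈ S → Coprime g m →
                           Connected (circulant m S)
  coprime-jump⇒connected {S} {g} proper g∈S g⊥m x y =
    reach-by-steps 1 unit-step (toℕ y + m ∸ toℕ x) (begin
      (toℕ x + (toℕ y + m ∸ toℕ x) * 1) % m  ≡⟨ cong (λ r → (toℕ x + r) % m) (*-identityʳ _) ⟩
      (toℕ x + (toℕ y + m ∸ toℕ x)) % m      ≡⟨ cong (_% m) (m+[n∸m]≡n x≤y+m) ⟩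
      (toℕ y + m) % m                        ≡⟨ +m≋ (toℕ y) ⟩
      toℕ y % m                              ∎)
    where
    open ≡-Reasoning
    x≤y+m : toℕ x ≤ toℕ y + m
    x≤y+m = ≤-trans (<⇒≤ (toℕ<n x)) (m≤n+m m (toℕ y))
    g-step : ∀ z → Reach (circulant m S) z (z ⊞ g)
    g-step z = step (jump-adjacent proper g∈S z) here
    unit-step : ∀ z → Reach (circulant m S) z (z ⊞ 1)
    unit-step z = let k , kg≋1 = coprime⇒invertible g⊥m in
      reach-by-steps g g-step k (trans (≋-+ˡ (toℕ z) kg≋1) (sym (toℕ-⊞ z 1)))

  jumpsBy-∣ : ∀ {d u v s} → d ∣ m → d ∣ s → T (jumpsBy u v s) → d ∣ ∣ u - v ∣
  jumpsBy-∣ d∣m d∣s t with Equivalence.to T-∨ t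
  ... | inj₁ d≡s   = subst (_ ∣_) (sym (≡ᵇ⇒≡ _ _ d≡s)) d∣s
  ... | inj₂ d≡m∸s = subst (_ ∣_) (sym (≡ᵇ⇒≡ _ _ d≡m∸s)) (∣m∣n⇒∣m∸n d∣m d∣s)

  adjacent-%≡ : ∀ {S d} .{{_ : NonZero d}} → d ∣ m → All (d ∣_) S →
                ∀ {i j} → circulant m S i j ≡ true → toℕ i % d ≡ toℕ j % d
  adjacent-%≡ {S} d∣m d∣S {i} {j} adj
    with lookupAny d∣S (any⁻ _ S (proj₂ (Equivalence.to T-∧ (Equivalence.from T-≡ adj))))
  ... | d∣s , jumps = d∣∣m-n∣⇒m%d≡n%d (jumpsBy-∣ {u = toℕ i} {v = toℕ j} d∣m d∣s jumps)

  reach-%-invariant : ∀ {S d} .{{_ : NonZero d}} → d ∣ m → All (d ∣_) S →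
                      ∀ {i j} → Reach (circulant m S) i j → toℕ i % d ≡ toℕ j % d
  reach-%-invariant d∣m d∣S here         = refl
  reach-%-invariant d∣m d∣S (step adj p) = trans (adjacent-%≡ d∣m d∣S adj) (reach-%-invariant d∣m d∣S p)

  even-jumps⇒disconnected : ∀ {S} → 2 ∣ m → All (2 ∣_) S → ¬ Connected (circulant m S)
  even-jumps⇒disconnected 2∣m 2∣S connected = 0≢1 (begin
    0                     ≡⟨ cong (_% 2) (toℕ-fromℕ< 0<m) ⟨
    toℕ (fromℕ< 0<m) % 2  ≡⟨ reach-%-invariant 2∣m 2∣S (connected (fromℕ< 0<m) (fromℕ< 1<m)) ⟩
    toℕ (fromℕ< 1<m) % 2  ≡⟨ cong (_% 2) (toℕ-fromℕ< 1<m) ⟩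
    1                     ∎)
    where
    open ≡-Reasoning
    1<m : 1 < m
    1<m = ∣⇒≤ 2∣m
    0<m : 0 < m
    0<m = <⇒≤ 1<m
    0≢1 : 0 ≢ 1
    0≢1 ()

-- The antipodal map

module Antipodal (m h : ℕ) .{{_ : NonZero m}} (m≡h+h : m ≡ h + h) where
  open Circulant m

  antipode : Fin m → Fin m
  antipode x = x ⊞ h

  h≤m : h ≤ m
  h≤m = subst (h ≤_) (sym m≡h+h) (m≤m+n h h)

  0<h : 0 < h
  0<h = n≢0⇒n>0 λ h≡0 → ≢-nonZero⁻¹ m (trans m≡h+h (cong (λ r → r + r) h≡0))

  h<m : h < m
  h<m = subst (h <_) (sym m≡h+h) (m<m+n h 0<h)

  antipode-involutive : ∀ x → antipode (antipode x) ≡ x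
  antipode-involutive x = toℕ-≋⇒≡ (begin
    toℕ (antipode (antipode x)) % m  ≡⟨ toℕ-⊞ (antipode x) h ⟩
    (toℕ (antipode x) + h) % m       ≡⟨ ≋-+ʳ h (toℕ-⊞ x h) ⟩
    (toℕ x + h + h) % m              ≡⟨ cong (_% m) (+-assoc (toℕ x) h h) ⟩
    (toℕ x + (h + h)) % m            ≡⟨ cong (λ r → (toℕ x + r) % m) m≡h+h ⟨
    (toℕ x + m) % m                  ≡⟨ +m≋ (toℕ x) ⟩
    toℕ x % m                        ∎)
    where open ≡-Reasoning

  -- Modulo m = 2h we have h + s ≡ -t and h - s ≡ t, so the shift by h swaps the two signs.
  Jump-antipodal : ∀ {s t a x} → s + t ≡ h → a ≋ x + h → ∀ y → Jump s a y ⇔ Jump t x y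
  Jump-antipodal {s} {t} {a} {x} s+t≡h a≋x+h y = mk⇔
    (Sum.swap ∘ Sum.map (trans (sym a+s≋x+[m∸t])) (trans (sym a+[m∸s]≋x+t)))
    (Sum.map (trans a+s≋x+[m∸t]) (trans a+[m∸s]≋x+t) ∘ Sum.swap)
    where
    open ≡-Reasoning
    m∸s≡t+h : m ∸ s ≡ t + h
    m∸s≡t+h = begin
      m ∸ s              ≡⟨ cong (_∸ s) (trans m≡h+h (cong (_+ h) (sym s+t≡h))) ⟩
      s + t + h ∸ s      ≡⟨ cong (_∸ s) (+-assoc s t h) ⟩
      s + (t + h) ∸ s    ≡⟨ m+n∸m≡n s (t + h) ⟩
      t + h              ∎
    m∸t≡h+s : m ∸ t ≡ h + s
    m∸t≡h+s = begin
      m ∸ t              ≡⟨ cong (_∸ t) (trans m≡h+h (cong (h +_) (sym s+t≡h))) ⟩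
      h + (s + t) ∸ t    ≡⟨ cong (_∸ t) (+-assoc h s t) ⟨
      h + s + t ∸ t      ≡⟨ m+n∸n≡m (h + s) t ⟩
      h + s              ∎
    a+s≋x+[m∸t] : a + s ≋ x + (m ∸ t)
    a+s≋x+[m∸t] = begin
      (a + s) % m        ≡⟨ ≋-+ʳ s a≋x+h ⟩
      (x + h + s) % m    ≡⟨ cong (_% m) (trans (+-assoc x h s) (cong (x +_) (sym m∸t≡h+s))) ⟩
      (x + (m ∸ t)) % m  ∎
    a+[m∸s]≋x+t : a + (m ∸ s) ≋ x + t
    a+[m∸s]≋x+t = begin
      (a + (m ∸ s)) % m      ≡⟨ ≋-+ʳ (m ∸ s) a≋x+h ⟩
      (x + h + (m ∸ s)) % m  ≡⟨ cong (λ r → (x + h + r) % m) m∸s≡t+h ⟩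
      (x + h + (t + h)) % m  ≡⟨ cong (_% m) (trans (rearrange x h t) (cong (x + t +_) (sym m≡h+h))) ⟩
      (x + t + m) % m        ≡⟨ +m≋ (x + t) ⟩
      (x + t) % m            ∎
      where
      rearrange : ∀ x h t → x + h + (t + h) ≡ x + t + (h + h)
      rearrange = solve-∀

  jumpsBy-antipode : ∀ {s} → s ≤ h → ∀ (x y : Fin m) →
                     jumpsBy (toℕ (antipode x)) (toℕ y) s ≡ jumpsBy (toℕ x) (toℕ y) (h ∸ s)
  jumpsBy-antipode {s} s≤h x y = T⇔T⇒≡ (⇔.trans
    (T-jumpsBy⇔Jump (toℕ<n (antipode x)) (toℕ<n y) (≤-trans s≤h h≤m))
    (⇔.trans (Jump-antipodal (m+[n∸m]≡n s≤h) (toℕ-⊞ x h) (toℕ y))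
             (⇔.sym (T-jumpsBy⇔Jump (toℕ<n x) (toℕ<n y) (≤-trans (m∸n≤m h s) h≤m)))))

  any-jumpsBy-antipode : ∀ {S} → All (_≤ h) S → ∀ (x y : Fin m) →
    any (jumpsBy (toℕ (antipode x)) (toℕ y)) S ≡ any (jumpsBy (toℕ x) (toℕ y)) (map (h ∸_) S)
  any-jumpsBy-antipode []           x y = refl
  any-jumpsBy-antipode (s≤h ∷ S≤h) x y =
    cong₂ _∨_ (jumpsBy-antipode s≤h x y) (any-jumpsBy-antipode S≤h x y)

  module _ {S : List ℕ} (S-bounds : All (λ s → 0 < s × s < h) S) where

    G₁ G₂ : Graph m
    G₁ = circulant m (h ∷ S)
    G₂ = circulant m (map (h ∸_) S)

    S≤h : All (_≤ h) S
    S≤h = All.map (λ (_ , s<h) → <⇒≤ s<h) S-bounds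

    G₁-proper : All (ProperJump m) (h ∷ S)
    G₁-proper = (0<h , h<m) ∷ All.map (λ (0<s , s<h) → 0<s , <-≤-trans s<h h≤m) S-bounds

    G₂-proper : All (ProperJump m) (map (h ∸_) S)
    G₂-proper = map⁺ (All.map (λ {s} (_ , s<h) → m<n⇒0<n∸m s<h , ≤-<-trans (m∸n≤m h s) h<m) S-bounds)

    G₁-antipode : ∀ x y → G₁ (antipode x) y ≡ (toℕ x ≡ᵇ toℕ y) xor G₂ x y
    G₁-antipode x y = begin
      G₁ (antipode x) y
        ≡⟨ circulant≡any G₁-proper (antipode x) y ⟩
      jumpsBy (toℕ (antipode x)) (toℕ y) h ∨ any (jumpsBy (toℕ (antipode x)) (toℕ y)) S
        ≡⟨ cong₂ _∨_ (jumpsBy-antipode ≤-refl x y) (any-jumpsBy-antipode S≤h x y) ⟩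
      jumpsBy (toℕ x) (toℕ y) (h ∸ h) ∨ adjacent₂
        ≡⟨ cong (λ r → jumpsBy (toℕ x) (toℕ y) r ∨ adjacent₂) (n∸n≡0 h) ⟩
      jumpsBy (toℕ x) (toℕ y) 0 ∨ adjacent₂
        ≡⟨ cong (_∨ adjacent₂) (jumpsBy-zero (toℕ<n x) (toℕ<n y)) ⟩
      (toℕ x ≡ᵇ toℕ y) ∨ adjacent₂
        ≡⟨ ∨≡xor-not-∧ (toℕ x ≡ᵇ toℕ y) adjacent₂ ⟩
      (toℕ x ≡ᵇ toℕ y) xor G₂ x y
        ∎
      where
      open ≡-Reasoning
      adjacent₂ : Bool
      adjacent₂ = any (jumpsBy (toℕ x) (toℕ y)) (map (h ∸_) S)

    openNbSum-antipode : ∀ {k} (f : Fin m → Z2n k) x → openNbSum G₁ f (antipode x) ≡ closedNbSum G₂ f x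
    openNbSum-antipode f x = openNbSum≡closedNbSum G₁ G₂ f {antipode x} {x} (G₁-antipode x)

    open-magic⇔closed-magic : ∀ {k} (f : Fin m → Z2n k) →
                              (∀ z → openNbSum G₁ f z ≡ 0ᵥ) ⇔ (∀ x → closedNbSum G₂ f x ≡ 0ᵥ)
    open-magic⇔closed-magic f = mk⇔
      (λ open≡0 x → trans (sym (openNbSum-antipode f x)) (open≡0 (antipode x)))
      (λ closed≡0 z → begin
        openNbSum G₁ f z                        ≡⟨ cong (openNbSum G₁ f) (antipode-involutive z) ⟨
        openNbSum G₁ f (antipode (antipode z))  ≡⟨ openNbSum-antipode f (antipode z) ⟩
        closedNbSum G₂ f (antipode z)           ≡⟨ closed≡0 (antipode z) ⟩
        0ᵥ                                      ∎)
      where open ≡-Reasoning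

-- Connectivity of circulants of order 2ⁿ

any-odd-antipodal : ∀ {h S} → 2 ∣ h → All (_≤ h) S →
                    Any (2 ∤_) (h ∷ S) ⇔ Any (2 ∤_) (map (h ∸_) S)
any-odd-antipodal {h} {S} 2∣h S≤h = mk⇔ to from
  where
  parity-complement : ∀ {s} → s ∈ S → 2 ∣ h ∸ s ⇔ 2 ∣ s
  parity-complement s∈S = ∣m∸n⇔∣n 2∣h (All.lookup S≤h s∈S)
  to : Any (2 ∤_) (h ∷ S) → Any (2 ∤_) (map (h ∸_) S)
  to (here 2∤h)  = contradiction 2∣h 2∤h
  to (there odd) = let (s , s∈S , 2∤s) = find odd in
    lose (∈-map⁺ (h ∸_) s∈S) (2∤s ∘ Equivalence.to (parity-complement s∈S))
  from : Any (2 ∤_) (map (h ∸_) S) → Any (2 ∤_) (h ∷ S)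
  from odd = let (s , s∈S , 2∤h∸s) = find (Any-map⁻ odd) in
    there (lose s∈S (2∤h∸s ∘ Equivalence.from (parity-complement s∈S)))

odd⇒coprime-2 : ∀ {g} → 2 ∤ g → Coprime g 2
odd⇒coprime-2 _   {0}             (_ , 0∣2)  = contradiction (0∣⇒≡0 0∣2) λ ()
odd⇒coprime-2 _   {1}             _          = refl
odd⇒coprime-2 2∤g {2}             (2∣g , _)  = contradiction 2∣g 2∤g
odd⇒coprime-2 _   {suc (suc (suc _))} (_ , d∣2) = contradiction (∣⇒≤ d∣2) λ { (s≤s (s≤s ())) }

odd⇒coprime-2^ : ∀ n {g} → 2 ∤ g → Coprime g (2 ^ n)
odd⇒coprime-2^ zero    _   (_ , d∣1)           = ∣1⇒≡1 d∣1
odd⇒coprime-2^ (suc n) 2∤g (d∣g , d∣2*2^n) =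
  odd⇒coprime-2^ n 2∤g (d∣g , coprime-divisor (odd⇒coprime-2 (2∤g ∘ flip ∣-trans d∣g)) d∣2*2^n)

module _ (n : ℕ) where

  private instance
    2^[1+n]≢0 : NonZero (2 ^ suc n)
    2^[1+n]≢0 = m^n≢0 2 (suc n)

  open Circulant (2 ^ suc n)

  connected⇔any-odd : ∀ {S} → All (ProperJump (2 ^ suc n)) S →
                      Connected (circulant (2 ^ suc n) S) ⇔ Any (2 ∤_) S
  connected⇔any-odd {S} proper = mk⇔ connected⇒odd odd⇒connected
    where
    connected⇒odd : Connected (circulant (2 ^ suc n) S) → Any (2 ∤_) S
    connected⇒odd connected with any? (λ s → ¬? (2 ∣? s)) S
    ... | yes odd = odd
    ... | no ¬odd = contradiction connected
          (even-jumps⇒disconnected (m∣m*n (2 ^ n)) (All.map (decidable-stable (2 ∣? _)) (¬Any⇒All¬ S ¬odd)))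
    odd⇒connected : Any (2 ∤_) S → Connected (circulant (2 ^ suc n) S)
    odd⇒connected odd = let (g , g∈S , 2∤g) = find odd in
      coprime-jump⇒connected proper g∈S (odd⇒coprime-2^ (suc n) 2∤g)

2^[1+n]/2≡2^n : ∀ n → 2 ^ suc n / 2 ≡ 2 ^ n
2^[1+n]/2≡2^n n = trans (cong (_/ 2) (*-comm 2 (2 ^ n))) (m*n/n≡m (2 ^ n) 2)

mainTheorem6 : (n : ℕ) → 1 < n → (T : List ℕ) →
    All (λ s → 1 ≤ s × s < (2 ^ n) / 2) T →
    OpenXORMagic n (circulant (2 ^ n) (((2 ^ n) / 2) ∷ T)) ⇔
      ClosedXORMagic n (circulant (2 ^ n) (map (λ s → ((2 ^ n) / 2) ∸ s) T))
mainTheorem6 1 (s≤s ())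
mainTheorem6 (suc (suc k)) _ S S-bounds = mk⇔
  (λ (c , ℓ , open≡0)   → Equivalence.to connected⇔ c , ℓ ,
                          Equivalence.to (open-magic⇔closed-magic S-bounds (Bijection.to ℓ)) open≡0)
  (λ (c , ℓ , closed≡0) → Equivalence.from connected⇔ c , ℓ ,
                          Equivalence.from (open-magic⇔closed-magic S-bounds (Bijection.to ℓ)) closed≡0)
  where
  instance
    2^[2+k]≢0 : NonZero (2 ^ suc (suc k))
    2^[2+k]≢0 = m^n≢0 2 (suc (suc k))
  h : ℕ
  h = 2 ^ suc (suc k) / 2
  h≡2^[1+k] : h ≡ 2 ^ suc k
  h≡2^[1+k] = 2^[1+n]/2≡2^n (suc k)
  m≡h+h : 2 ^ suc (suc k) ≡ h + h
  m≡h+h = trans (cong (2 ^ suc k +_) (+-identityʳ (2 ^ suc k))) (cong (λ r → r + r) (sym h≡2^[1+k]))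
  open Antipodal (2 ^ suc (suc k)) h m≡h+h
  connected⇔ : Connected (G₁ S-bounds) ⇔ Connected (G₂ S-bounds)
  connected⇔ = ⇔.trans (connected⇔any-odd (suc k) (G₁-proper S-bounds))
              (⇔.trans (any-odd-antipodal (subst (2 ∣_) (sym h≡2^[1+k]) (m∣m*n (2 ^ k))) (S≤h S-bounds))
                       (⇔.sym (connected⇔any-odd (suc k) (G₂-proper S-bounds))))
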